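{- Let $G$ be a simple graph with degree function $d$, and let $M$ be a maximum size matching in $G$. Let $U_M$ be the set of vertices not covered by $M$. Then $$\sum_{uv\in M}\max\{d(u)-1,\,d(v)-1\}+\big|\{uv\in M : d(u)=d(v)=2\}\big|\ge\sum_{w\in U_M}d(w).$$
   Context: A matching is a set of pairwise disjoint edges; a maximum matching is one of largest cardinality. A vertex is covered by $M$ if some edge of $M$ is incident to it. -}

module Defs where

open import Data.Nat using (ℕ; zero; suc; _+_; _∸_; _⊔_; _≤_; _≟_)
open import Data.Bool using (Bool; true; false; if_then_else_)
open import Data.Fin using (Fin)
import Data.Fin as Fin
open import Data.Product using (_×_; _,_; proj₁; proj₂)
open import Data.List using (List; []; _∷_; length; map; concatMap; filter; allFin)
open import Data.Nat.ListAction using (sum)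
open import Data.List.Relation.Unary.All using (All)
open import Data.List.Relation.Unary.Unique.Propositional using (Unique)
open import Data.List.Membership.Propositional using (_∈_)
import Data.List.Membership.DecPropositional as DecMem
open import Relation.Nullary using (¬_; ¬?)
open import Relation.Nullary.Decidable using (_×-dec_)
open import Relation.Binary.PropositionalEquality using (_≡_)

record SimpleGraph (n : ℕ) : Set where
  field
    Adj    : Fin n → Fin n → Bool
    sym    : ∀ i j → Adj i j ≡ Adj j i
    irrefl : ∀ i → Adj i i ≡ false
open SimpleGraph public

degree : ∀ {n} → SimpleGraph n → Fin n → ℕ
degree {n} G v = sum (map (λ j → if Adj G v j then 1 else 0) (allFin n))

Edge : ℕ → Set
Edge n = Fin n × Fin n

endpoints : ∀ {n} → List (Edge n) → List (Fin n)
endpoints = concatMap (λ e → proj₁ e ∷ proj₂ e ∷ [])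

-- M is a matching: every pair is an edge of G and the edges are pairwise
-- disjoint (all endpoints listed are distinct; in particular no edge repeats).
IsMatching : ∀ {n} → SimpleGraph n → List (Edge n) → Set
IsMatching G M = All (λ e → Adj G (proj₁ e) (proj₂ e) ≡ true) M × Unique (endpoints M)

IsMaximumMatching : ∀ {n} → SimpleGraph n → List (Edge n) → Set
IsMaximumMatching G M =
  IsMatching G M × (∀ M′ → IsMatching G M′ → length M′ ≤ length M)

Covered : ∀ {n} → List (Edge n) → Fin n → Set
Covered M v = v ∈ endpoints M

uncovered : ∀ {n} → List (Edge n) → List (Fin n)
uncovered {n} M = filter (λ w → ¬? (w ∈? endpoints M)) (allFin n)
  where open DecMem (Fin._≟_ {n}) using (_∈?_)

maxTerm : ∀ {n} → SimpleGraph n → List (Edge n) → ℕ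
maxTerm G M = sum (map (λ e → (degree G (proj₁ e) ∸ 1) ⊔ (degree G (proj₂ e) ∸ 1)) M)

twoTwoCount : ∀ {n} → SimpleGraph n → List (Edge n) → ℕ
twoTwoCount G M =
  length (filter (λ e → (degree G (proj₁ e) ≟ 2) ×-dec (degree G (proj₂ e) ≟ 2)) M)

uncoveredDegreeSum : ∀ {n} → SimpleGraph n → List (Edge n) → ℕ
uncoveredDegreeSum G M = sum (map (degree G) (uncovered M))

{-# OPTIONS --safe #-}
-- Let U be the set of uncovered vertices and, for a vertex x, let c(x) be the
-- number of its neighbours in U. By maximality U is independent, so every edge
-- leaving U ends in a covered vertex and, counting these edges from both sides,
-- the right-hand side equals the sum of c(u) + c(v) over the edges uv of M. If
-- c(v) = 0 then c(u) ≤ d(u) − 1, since v is a neighbour of u outside U. If c(u)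
-- and c(v) are both positive, any w ~ u and w′ ~ v in U must coincide, as
-- otherwise w u v w′ is an augmenting path; hence c(u) = c(v) = 1 while
-- d(u), d(v) ≥ 2, and the edge contributes at least 2 to the left-hand side.
module Submission where

open import Defs hiding (sym)
open import Data.Bool using (true; false; if_then_else_)
open import Data.Fin using (Fin)
import Data.Fin as Fin
open import Data.List using (List; []; _∷_; _++_; length; map; filter; allFin; [_])
open import Data.List.Properties using (map-cong; length-++-sucʳ)
open import Data.List.Membership.Propositional using (_∈_; _∉_)
open import Data.List.Membership.Propositional.Properties
  using (∈-∃++; ∈-allFin; ∈-filter⁻)
import Data.List.Membership.DecPropositional as DecMem
open import Data.List.Relation.Binary.Permutation.Propositional
  using (_↭_; ↭-prep; ↭-swap; ↭-trans; ↭-refl; ↭-sym; ↭⇒↭ₛ)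
open import Data.List.Relation.Binary.Permutation.Propositional.Properties
  using (shift; map⁺; ∈-resp-↭)
import Data.List.Relation.Binary.Permutation.Setoid.Properties as PermutationSetoid
open import Data.List.Relation.Unary.All as All using (All; _∷_)
import Data.List.Relation.Unary.All.Properties as All
open import Data.List.Relation.Unary.Any using (here; there)
open import Data.List.Relation.Unary.AllPairs using ([]; _∷_)
open import Data.List.Relation.Unary.Unique.Propositional using (Unique)
import Data.List.Relation.Unary.Unique.Propositional.Properties as Unique
open import Data.Nat using (ℕ; suc; _+_; _∸_; _⊔_; _≤_; _≥_; z≤n; s≤s; _≟_)
open import Data.Nat.ListAction using (sum)
open import Data.Nat.ListAction.Properties using (sum-↭)
open import Data.Nat.Properties
  using (+-commutativeSemigroup; +-assoc; ≤-refl; ≤-trans; +-mono-≤; +-monoʳ-≤; +-identityʳ; m≤m+n; m≤m⊔n; m≤n⊔m; 1+n≰n; module ≤-Reasoning)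
open import Algebra.Properties.CommutativeSemigroup +-commutativeSemigroup using (interchange)
open import Data.Product using (_×_; _,_; proj₁; proj₂; ∃-syntax)
open import Level using (0ℓ)
open import Relation.Nullary using (¬_; ¬?; Dec; yes; no; does; contradiction)
open import Relation.Nullary.Decidable using (_×-dec_)
open import Relation.Unary using (Pred; Decidable)
open import Relation.Binary.PropositionalEquality
  using (_≡_; _≢_; refl; sym; trans; cong; cong₂; subst; setoid)

module _ {A : Set} where

  Unique-resp-↭ : ∀ {xs ys : List A} → xs ↭ ys → Unique xs → Unique ys
  Unique-resp-↭ p = PermutationSetoid.Unique-resp-↭ (setoid A) (↭⇒↭ₛ p)

  Unique-∷ : ∀ {x : A} {xs} → x ∉ xs → Unique xs → Unique (x ∷ xs)
  Unique-∷ x∉xs xs! = All.¬Any⇒All¬ _ x∉xs ∷ xs!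

  sum-map-++-∷ : ∀ (f : A → ℕ) x xs ys →
    sum (map f (xs ++ x ∷ ys)) ≡ f x + sum (map f (xs ++ ys))
  sum-map-++-∷ f x xs ys = sum-↭ (map⁺ f (shift x xs ys))

  sum-map-zero : ∀ (xs : List A) → sum (map (λ _ → 0) xs) ≡ 0
  sum-map-zero []       = refl
  sum-map-zero (_ ∷ xs) = sum-map-zero xs

  sum-map-+ : ∀ (f g : A → ℕ) xs →
    sum (map (λ x → f x + g x) xs) ≡ sum (map f xs) + sum (map g xs)
  sum-map-+ f g []       = refl
  sum-map-+ f g (x ∷ xs) = trans (cong (f x + g x +_) (sum-map-+ f g xs))
                                 (interchange (f x) (g x) _ _)

  sum-map-mono-≤ : ∀ {f g : A → ℕ} xs → (∀ {x} → x ∈ xs → f x ≤ g x) →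
    sum (map f xs) ≤ sum (map g xs)
  sum-map-mono-≤ []       f≤g = z≤n
  sum-map-mono-≤ (x ∷ xs) f≤g = +-mono-≤ (f≤g (here refl)) (sum-map-mono-≤ xs (λ y∈xs → f≤g (there y∈xs)))

  sum-map-≤-supported : ∀ (f : A → ℕ) {xs ys} → Unique xs →
    (∀ {x} → x ∈ xs → f x ≢ 0 → x ∈ ys) → sum (map f xs) ≤ sum (map f ys)
  sum-map-≤-supported f {[]}     _            _    = z≤n
  sum-map-≤-supported f {x ∷ xs} (x∉xs ∷ xs!) supp with f x ≟ 0
  ... | yes fx≡0 rewrite fx≡0 = sum-map-≤-supported f xs! (λ y∈xs → supp (there y∈xs))
  ... | no fx≢0 with ys₁ , ys₂ , refl ← ∈-∃++ (supp (here refl) fx≢0) = begin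
    f x + sum (map f xs)             ≤⟨ +-monoʳ-≤ (f x) (sum-map-≤-supported f xs! supp′) ⟩
    f x + sum (map f (ys₁ ++ ys₂))   ≡⟨ sym (sum-map-++-∷ f x ys₁ ys₂) ⟩
    sum (map f (ys₁ ++ x ∷ ys₂))     ∎
    where
    open ≤-Reasoning
    supp′ : ∀ {y} → y ∈ xs → f y ≢ 0 → y ∈ ys₁ ++ ys₂
    supp′ y∈xs fy≢0 with ∈-resp-↭ (shift x ys₁ ys₂) (supp (there y∈xs) fy≢0)
    ... | here refl = contradiction refl (All.lookup x∉xs y∈xs)
    ... | there y∈ys = y∈ys

sum-map-comm : ∀ {A B : Set} (g : A → B → ℕ) xs ys →
  sum (map (λ x → sum (map (g x) ys)) xs) ≡ sum (map (λ y → sum (map (λ x → g x y) xs)) ys)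
sum-map-comm g []       ys = sym (sum-map-zero ys)
sum-map-comm g (x ∷ xs) ys = trans (cong (sum (map (g x) ys) +_) (sum-map-comm g xs ys))
                                   (sym (sum-map-+ (g x) _ ys))

length-filter≡sum-map-indicator : ∀ {A : Set} {P : Pred A 0ℓ} (P? : Decidable P) xs →
  length (filter P? xs) ≡ sum (map (λ x → if does (P? x) then 1 else 0) xs)
length-filter≡sum-map-indicator P? []       = refl
length-filter≡sum-map-indicator P? (x ∷ xs) with does (P? x)
... | true  = cong suc (length-filter≡sum-map-indicator P? xs)
... | false = length-filter≡sum-map-indicator P? xs

bothTwo : ℕ → ℕ → ℕ
bothTwo a b = if does ((a ≟ 2) ×-dec (b ≟ 2)) then 1 else 0

2≤pred⊔pred+bothTwo : ∀ {a b} → 2 ≤ a → 2 ≤ b → 2 ≤ ((a ∸ 1) ⊔ (b ∸ 1)) + bothTwo a b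
2≤pred⊔pred+bothTwo {2}                 {2}                 _ _ = ≤-refl
2≤pred⊔pred+bothTwo {suc (suc (suc a))} {b}                 _ _ =
  ≤-trans (s≤s (s≤s z≤n)) (≤-trans (m≤m⊔n (suc (suc a)) (b ∸ 1)) (m≤m+n _ _))
2≤pred⊔pred+bothTwo {2}                 {suc (suc (suc b))} _ _ =
  ≤-trans (s≤s (s≤s z≤n)) (≤-trans (m≤n⊔m 1 (suc (suc b))) (m≤m+n _ _))
2≤pred⊔pred+bothTwo {2}                 {1}                 _ (s≤s ())
2≤pred⊔pred+bothTwo {2}                 {0}                 _ ()
2≤pred⊔pred+bothTwo {1}                 {b}                 (s≤s ()) _
2≤pred⊔pred+bothTwo {0}                 {b}                 () _

module _ {n : ℕ} where

  open DecMem (Fin._≟_ {n}) using (_∈?_)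

  ∈-uncovered⁻ : ∀ (M : List (Edge n)) {w} → w ∈ uncovered M → w ∉ endpoints M
  ∈-uncovered⁻ M w∈U = proj₂ (∈-filter⁻ (λ x → ¬? (x ∈? endpoints M)) {xs = allFin n} w∈U)

  uncovered-unique : ∀ (M : List (Edge n)) → Unique (uncovered M)
  uncovered-unique M = Unique.filter⁺ (λ x → ¬? (x ∈? endpoints M)) (Unique.allFin⁺ n)

  endpoints-++ : ∀ (M M′ : List (Edge n)) → endpoints (M ++ M′) ≡ endpoints M ++ endpoints M′
  endpoints-++ []      M′ = refl
  endpoints-++ (e ∷ M) M′ = cong (λ E → proj₁ e ∷ proj₂ e ∷ E) (endpoints-++ M M′)

  ∈⇒∈-endpoints : ∀ {M : List (Edge n)} {u v} → (u , v) ∈ M →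
    u ∈ endpoints M × v ∈ endpoints M
  ∈⇒∈-endpoints (here refl) = here refl , there (here refl)
  ∈⇒∈-endpoints (there e∈M) with u∈E , v∈E ← ∈⇒∈-endpoints e∈M = there (there u∈E) , there (there v∈E)

  sum-map-endpoints : ∀ (f : Fin n → ℕ) (M : List (Edge n)) →
    sum (map f (endpoints M)) ≡ sum (map (λ e → f (proj₁ e) + f (proj₂ e)) M)
  sum-map-endpoints f []            = refl
  sum-map-endpoints f ((u , v) ∷ M) = trans (cong (λ s → f u + (f v + s)) (sum-map-endpoints f M))
                                            (sym (+-assoc (f u) (f v) _))

module _ {n : ℕ} (G : SimpleGraph n) where

  open DecMem (Fin._≟_ {n}) using (_∈?_)

  infix 4 _~_
  _~_ : Fin n → Fin n → Set
  i ~ j = Adj G i j ≡ true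

  ~-sym : ∀ {i j} → i ~ j → j ~ i
  ~-sym {i} {j} i~j = trans (SimpleGraph.sym G j i) i~j

  ~⇒≢ : ∀ {i j} → i ~ j → i ≢ j
  ~⇒≢ {i} i~i refl with () ← trans (sym i~i) (irrefl G i)

  χ : Fin n → Fin n → ℕ
  χ i j = if Adj G i j then 1 else 0

  χ-sym : ∀ i j → χ i j ≡ χ j i
  χ-sym i j = cong (λ b → if b then 1 else 0) (SimpleGraph.sym G i j)

  χ≤1 : ∀ i j → χ i j ≤ 1
  χ≤1 i j with Adj G i j
  ... | true  = ≤-refl
  ... | false = z≤n

  χ≢0⇒~ : ∀ {i j} → χ i j ≢ 0 → i ~ j
  χ≢0⇒~ {i} {j} χ≢0 with Adj G i j
  ... | true  = refl
  ... | false = contradiction refl χ≢0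

  ~⇒χ≡1 : ∀ {i j} → i ~ j → χ i j ≡ 1
  ~⇒χ≡1 i~j rewrite i~j = refl

  -- degree G x is definitionally degreeIn (allFin n) x.
  degreeIn : List (Fin n) → Fin n → ℕ
  degreeIn S x = sum (map (χ x) S)

  degreeIn≢0⇒∃ : ∀ S {x} → degreeIn S x ≢ 0 → ∃[ w ] w ∈ S × x ~ w
  degreeIn≢0⇒∃ []          d≢0 = contradiction refl d≢0
  degreeIn≢0⇒∃ (w ∷ S) {x} d≢0 with Adj G x w in x~w
  ... | true  = w , here refl , x~w
  ... | false with w′ , w′∈S , x~w′ ← degreeIn≢0⇒∃ S d≢0 = w′ , there w′∈S , x~w′

  degreeIn-sum-comm : ∀ S T → sum (map (degreeIn S) T) ≡ sum (map (degreeIn T) S)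
  degreeIn-sum-comm S T = trans (sum-map-comm χ T S)
    (cong sum (map-cong (λ y → cong sum (map-cong (λ x → χ-sym x y) T)) S))

  degree≤degreeIn : ∀ {S x} → (∀ {y} → x ~ y → y ∈ S) → degree G x ≤ degreeIn S x
  degree≤degreeIn {x = x} nbrs⊆S =
    sum-map-≤-supported (χ x) (Unique.allFin⁺ n) (λ _ χ≢0 → nbrs⊆S (χ≢0⇒~ χ≢0))

  degreeIn≤degree∸1 : ∀ {S x y} → Unique S → y ∉ S → x ~ y → degreeIn S x ≤ degree G x ∸ 1
  degreeIn≤degree∸1 {S} {x} {y} S! y∉S x~y = pred-≤ (begin
    suc (degreeIn S x)   ≡⟨ cong (_+ degreeIn S x) (sym (~⇒χ≡1 x~y)) ⟩
    degreeIn (y ∷ S) x   ≤⟨ sum-map-≤-supported (χ x) (Unique-∷ y∉S S!) (λ {z} _ _ → ∈-allFin z) ⟩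
    degree G x           ∎)
    where
    open ≤-Reasoning
    pred-≤ : ∀ {a b} → suc a ≤ b → a ≤ b ∸ 1
    pred-≤ (s≤s a≤b) = a≤b

  2≤degree : ∀ {x y z} → y ≢ z → x ~ y → x ~ z → 2 ≤ degree G x
  2≤degree {x} {y} {z} y≢z x~y x~z = begin
    2                   ≡⟨ sym (cong₂ (λ a b → a + (b + 0)) (~⇒χ≡1 x~y) (~⇒χ≡1 x~z)) ⟩
    degreeIn (y ∷ z ∷ []) x  ≤⟨ sum-map-≤-supported (χ x) y∷z! (λ {w} _ _ → ∈-allFin w) ⟩
    degree G x          ∎
    where
    open ≤-Reasoning
    y∷z! : Unique (y ∷ z ∷ [])
    y∷z! = Unique-∷ (λ { (here y≡z) → y≢z y≡z }) (Unique-∷ (λ ()) [])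

  degreeIn≤1 : ∀ {S x z} → Unique S → (∀ {y} → y ∈ S → x ~ y → y ≡ z) → degreeIn S x ≤ 1
  degreeIn≤1 {S} {x} {z} S! nbrs≡z = begin
    degreeIn S x      ≤⟨ sum-map-≤-supported (χ x) {ys = [ z ]} S! (λ y∈S χ≢0 → here (nbrs≡z y∈S (χ≢0⇒~ χ≢0))) ⟩
    χ x z + 0         ≡⟨ +-identityʳ (χ x z) ⟩
    χ x z             ≤⟨ χ≤1 x z ⟩
    1                 ∎
    where open ≤-Reasoning

  augment-isMatching : ∀ M₁ M₂ {u v w w′} → IsMatching G (M₁ ++ (u , v) ∷ M₂) →
    w ∉ endpoints (M₁ ++ (u , v) ∷ M₂) → w′ ∉ endpoints (M₁ ++ (u , v) ∷ M₂) → w ≢ w′ →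
    w ~ u → v ~ w′ → IsMatching G ((w , u) ∷ (v , w′) ∷ M₁ ++ M₂)
  augment-isMatching M₁ M₂ {u} {v} {w} {w′} (edges , E!) w∉E w′∉E w≢w′ w~u v~w′ =
    w~u ∷ v~w′ ∷ edges′ , Unique-resp-↭ reorder (Unique-∷ w∉ (Unique-∷ w′∉ (Unique-resp-↭ split E!)))
    where
    rest = endpoints (M₁ ++ M₂)
    split : endpoints (M₁ ++ (u , v) ∷ M₂) ↭ u ∷ v ∷ rest
    split rewrite endpoints-++ M₁ ((u , v) ∷ M₂) | endpoints-++ M₁ M₂ =
      ↭-trans (shift u (endpoints M₁) (v ∷ endpoints M₂)) (↭-prep u (shift v (endpoints M₁) (endpoints M₂)))
    reorder : w ∷ w′ ∷ u ∷ v ∷ rest ↭ w ∷ u ∷ v ∷ w′ ∷ rest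
    reorder = ↭-prep w (↭-trans (↭-swap w′ u ↭-refl) (↭-prep u (↭-swap w′ v ↭-refl)))
    w′∉ : w′ ∉ u ∷ v ∷ rest
    w′∉ w′∈ = w′∉E (∈-resp-↭ (↭-sym split) w′∈)
    w∉ : w ∉ w′ ∷ u ∷ v ∷ rest
    w∉ (here w≡w′) = w≢w′ w≡w′
    w∉ (there w∈)  = w∉E (∈-resp-↭ (↭-sym split) w∈)
    edges′ : All (λ e → proj₁ e ~ proj₂ e) (M₁ ++ M₂)
    edges′ with edges₁ , _ ∷ edges₂ ← All.++⁻ M₁ edges = All.++⁺ edges₁ edges₂

  module _ {M : List (Edge n)} (M-max : IsMaximumMatching G M) where

    private
      isMatching = proj₁ M-max
      maximal    = proj₂ M-max
      U          = uncovered M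
      U!         = uncovered-unique M

    uncovered-independent : ∀ {w w′} → w ∉ endpoints M → w′ ∉ endpoints M → ¬ w ~ w′
    uncovered-independent {w} {w′} w∉E w′∉E w~w′ =
      1+n≰n (maximal ((w , w′) ∷ M) (w~w′ ∷ proj₁ isMatching , Unique-∷ w∉ (Unique-∷ w′∉E (proj₂ isMatching))))
      where
      w∉ : w ∉ w′ ∷ endpoints M
      w∉ (here w≡w′) = ~⇒≢ w~w′ w≡w′
      w∉ (there w∈E) = w∉E w∈E

    uncovered-neighbour-covered : ∀ {w y} → w ∈ U → w ~ y → y ∈ endpoints M
    uncovered-neighbour-covered {w} {y} w∈U w~y with y ∈? endpoints M
    ... | yes y∈E = y∈E
    ... | no y∉E  = contradiction w~y (uncovered-independent (∈-uncovered⁻ M w∈U) y∉E)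

    -- Otherwise w u v w′ is an augmenting path.
    uncovered-ends-coincide : ∀ {u v w w′} → (u , v) ∈ M → w ∉ endpoints M → w′ ∉ endpoints M →
      w ~ u → v ~ w′ → w ≡ w′
    uncovered-ends-coincide {u} {v} {w} {w′} uv∈M w∉E w′∉E w~u v~w′ with w Fin.≟ w′
    ... | yes w≡w′ = w≡w′
    ... | no w≢w′ with M₁ , M₂ , refl ← ∈-∃++ uv∈M =
      contradiction (subst (2 + length (M₁ ++ M₂) ≤_) (length-++-sucʳ M₁ (u , v) M₂) longer) 1+n≰n
      where
      longer : 2 + length (M₁ ++ M₂) ≤ length (M₁ ++ (u , v) ∷ M₂)
      longer = maximal _ (augment-isMatching M₁ M₂ isMatching w∉E w′∉E w≢w′ w~u v~w′)

    matched-degreeIn≤degree∸1 : ∀ {x y} → x ~ y → y ∈ endpoints M → degreeIn U x ≤ degree G x ∸ 1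
    matched-degreeIn≤degree∸1 x~y y∈E = degreeIn≤degree∸1 U! (λ y∈U → ∈-uncovered⁻ M y∈U y∈E) x~y

    matched-2≤degree : ∀ {x y} → x ~ y → y ∈ endpoints M → degreeIn U x ≢ 0 → 2 ≤ degree G x
    matched-2≤degree x~y y∈E d≢0 with w , w∈U , x~w ← degreeIn≢0⇒∃ U d≢0 =
      2≤degree (λ { refl → ∈-uncovered⁻ M w∈U y∈E }) x~y x~w

    degreeIn≤1ˡ : ∀ {u v} → (u , v) ∈ M → degreeIn U v ≢ 0 → degreeIn U u ≤ 1
    degreeIn≤1ˡ uv∈M d≢0 with w′ , w′∈U , v~w′ ← degreeIn≢0⇒∃ U d≢0 = degreeIn≤1 U! λ w∈U u~w →
      uncovered-ends-coincide uv∈M (∈-uncovered⁻ M w∈U) (∈-uncovered⁻ M w′∈U) (~-sym u~w) v~w′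

    degreeIn≤1ʳ : ∀ {u v} → (u , v) ∈ M → degreeIn U u ≢ 0 → degreeIn U v ≤ 1
    degreeIn≤1ʳ uv∈M d≢0 with w , w∈U , u~w ← degreeIn≢0⇒∃ U d≢0 = degreeIn≤1 U! λ w′∈U v~w′ →
      sym (uncovered-ends-coincide uv∈M (∈-uncovered⁻ M w∈U) (∈-uncovered⁻ M w′∈U) (~-sym u~w) v~w′)

    edge-bound : ∀ {e} → e ∈ M →
      degreeIn U (proj₁ e) + degreeIn U (proj₂ e) ≤
        ((degree G (proj₁ e) ∸ 1) ⊔ (degree G (proj₂ e) ∸ 1)) + bothTwo (degree G (proj₁ e)) (degree G (proj₂ e))
    edge-bound {u , v} uv∈M = by-cases (degreeIn U u ≟ 0) (degreeIn U v ≟ 0)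
      where
      du = degree G u
      dv = degree G v
      u~v = All.lookup (proj₁ isMatching) uv∈M
      u∈E = proj₁ (∈⇒∈-endpoints uv∈M)
      v∈E = proj₂ (∈⇒∈-endpoints uv∈M)
      by-cases : Dec (degreeIn U u ≡ 0) → Dec (degreeIn U v ≡ 0) →
        degreeIn U u + degreeIn U v ≤ ((du ∸ 1) ⊔ (dv ∸ 1)) + bothTwo du dv
      by-cases _ (yes dv≡0) rewrite dv≡0 | +-identityʳ (degreeIn U u) =
        ≤-trans (matched-degreeIn≤degree∸1 u~v v∈E) (≤-trans (m≤m⊔n _ _) (m≤m+n _ _))
      by-cases (yes du≡0) _ rewrite du≡0 =
        ≤-trans (matched-degreeIn≤degree∸1 (~-sym u~v) u∈E) (≤-trans (m≤n⊔m (du ∸ 1) _) (m≤m+n _ _))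
      by-cases (no du≢0) (no dv≢0) =
        ≤-trans (+-mono-≤ (degreeIn≤1ˡ uv∈M dv≢0) (degreeIn≤1ʳ uv∈M du≢0))
                (2≤pred⊔pred+bothTwo (matched-2≤degree u~v v∈E du≢0) (matched-2≤degree (~-sym u~v) u∈E dv≢0))

lemma5p3 : ∀ {n : ℕ} (G : SimpleGraph n) (M : List (Edge n)) →
    IsMaximumMatching G M →
    maxTerm G M + twoTwoCount G M ≥ uncoveredDegreeSum G M
lemma5p3 {n} G M M-max = begin
  sum (map (degree G) U)
    ≤⟨ sum-map-mono-≤ U (λ w∈U → degree≤degreeIn G (uncovered-neighbour-covered G M-max w∈U)) ⟩
  sum (map (degreeIn G (endpoints M)) U)
    ≡⟨ degreeIn-sum-comm G (endpoints M) U ⟩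
  sum (map (degreeIn G U) (endpoints M))
    ≡⟨ sum-map-endpoints (degreeIn G U) M ⟩
  sum (map (λ e → degreeIn G U (proj₁ e) + degreeIn G U (proj₂ e)) M)
    ≤⟨ sum-map-mono-≤ M (edge-bound G M-max) ⟩
  sum (map (λ e → maxPart e + twoTwoPart e) M)
    ≡⟨ sum-map-+ maxPart twoTwoPart M ⟩
  maxTerm G M + sum (map twoTwoPart M)
    ≡⟨ cong (maxTerm G M +_) (sym (length-filter≡sum-map-indicator _ M)) ⟩
  maxTerm G M + twoTwoCount G M ∎
  where
  open ≤-Reasoning
  U = uncovered M
  maxPart twoTwoPart : Edge n → ℕ
  maxPart    (u , v) = (degree G u ∸ 1) ⊔ (degree G v ∸ 1)
  twoTwoPart (u , v) = bothTwo (degree G u) (degree G v)
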